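{- Let $M$ be a finite set-homogeneous tournament. Then $M$ is homogeneous, and so $M$ has size $1$ or is isomorphic to the directed triangle $D_3$.
   Context: A tournament is a set with an irreflexive antisymmetric relation $\to$ such that any two distinct vertices $a,b$ satisfy exactly one of $a\to b$, $b\to a$. It is set-homogeneous if whenever $U,V$ are isomorphic finite induced substructures there is an automorphism $g$ with $U^g=V$, and homogeneous if every isomorphism between finite induced substructures extends to an automorphism. $D_3$ is the tournament on $\{0,1,2\}$ with arcs $0\to1\to2\to0$. -}

module Defs where

open import Level using (0ℓ)
open import Data.Nat using (ℕ)
open import Data.Fin using (Fin; zero; suc)
open import Data.Fin.Subset using (Subset; _∈_)
open import Data.Product using (Σ; ∃; _×_; _,_)
open import Data.Sum using (_⊎_)
open import Data.Empty using (⊥)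
open import Relation.Nullary using (¬_)
open import Relation.Binary.PropositionalEquality using (_≡_; _≢_)
open import Function.Bundles using (_↔_; Inverse)

record Tournament (n : ℕ) : Set₁ where
  field
    _⇒_     : Fin n → Fin n → Set
    irrefl  : ∀ a → ¬ (a ⇒ a)
    antisym : ∀ a b → a ⇒ b → ¬ (b ⇒ a)
    total   : ∀ a b → a ≢ b → (a ⇒ b) ⊎ (b ⇒ a)

open Tournament public

infix 3 _⇔_
_⇔_ : Set → Set → Set
A ⇔ B = (A → B) × (B → A)

record PartialIso {n : ℕ} (T : Tournament n) (U V : Subset n) (f : Fin n → Fin n) : Set where
  field
    maps-into : ∀ x → x ∈ U → f x ∈ V
    inj-on    : ∀ x y → x ∈ U → y ∈ U → f x ≡ f y → x ≡ y
    onto      : ∀ y → y ∈ V → ∃ λ x → x ∈ U × f x ≡ y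
    arcs      : ∀ x y → x ∈ U → y ∈ U → (_⇒_ T x y ⇔ _⇒_ T (f x) (f y))

_≅[_]_ : {n : ℕ} → Subset n → Tournament n → Subset n → Set
U ≅[ T ] V = ∃ λ f → PartialIso T U V f

record Automorphism {n : ℕ} (T : Tournament n) : Set where
  field
    perm : Fin n ↔ Fin n
    arcs : ∀ x y → _⇒_ T x y ⇔ _⇒_ T (Inverse.to perm x) (Inverse.to perm y)

open Automorphism public

aut : {n : ℕ} {T : Tournament n} → Automorphism T → Fin n → Fin n
aut g = Inverse.to (perm g)

-- Every finite subset of Fin n is finite, so all induced substructures are
-- given by a Subset n.
IsSetHomogeneous : {n : ℕ} → Tournament n → Set
IsSetHomogeneous {n} T =
  ∀ (U V : Subset n) → U ≅[ T ] V →
    Σ (Automorphism T) λ g → ∀ x → (x ∈ U ⇔ aut g x ∈ V)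

IsHomogeneous : {n : ℕ} → Tournament n → Set
IsHomogeneous {n} T =
  ∀ (U V : Subset n) (f : Fin n → Fin n) → PartialIso T U V f →
    Σ (Automorphism T) λ g → ∀ x → x ∈ U → aut g x ≡ f x

data D3-arc : Fin 3 → Fin 3 → Set where
  a01 : D3-arc zero (suc zero)
  a12 : D3-arc (suc zero) (suc (suc zero))
  a20 : D3-arc (suc (suc zero)) zero

D3 : Tournament 3
D3 = record { _⇒_ = D3-arc ; irrefl = irr ; antisym = anti ; total = tot }
  where
  irr : ∀ a → ¬ D3-arc a a
  irr _ ()
  anti : ∀ a b → D3-arc a b → ¬ D3-arc b a
  anti _ _ a01 ()
  anti _ _ a12 ()
  anti _ _ a20 ()
  tot : ∀ a b → a ≢ b → D3-arc a b ⊎ D3-arc b a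
  tot zero zero ne = Data.Empty.⊥-elim (ne Relation.Binary.PropositionalEquality.refl)
  tot zero (suc zero) _ = Data.Sum.inj₁ a01
  tot zero (suc (suc zero)) _ = Data.Sum.inj₂ a20
  tot (suc zero) zero _ = Data.Sum.inj₂ a01
  tot (suc zero) (suc zero) ne = Data.Empty.⊥-elim (ne Relation.Binary.PropositionalEquality.refl)
  tot (suc zero) (suc (suc zero)) _ = Data.Sum.inj₁ a12
  tot (suc (suc zero)) zero _ = Data.Sum.inj₁ a20
  tot (suc (suc zero)) (suc zero) _ = Data.Sum.inj₂ a12
  tot (suc (suc zero)) (suc (suc zero)) ne = Data.Empty.⊥-elim (ne Relation.Binary.PropositionalEquality.refl)

record _≅ᵀ_ {m n : ℕ} (S : Tournament m) (T : Tournament n) : Set where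
  field
    bij  : Fin m ↔ Fin n
    arcs : ∀ x y → _⇒_ S x y ⇔ _⇒_ T (Inverse.to bij x) (Inverse.to bij y)

-- Set-homogeneity passes from a tournament to the out- and in-neighbourhood
-- of any vertex v: an isomorphism between subsets of a neighbourhood, extended
-- by v ↦ v, is realised by an automorphism, which must fix v. By induction on
-- size, both neighbourhoods are therefore single vertices or directed
-- triangles. Two single neighbourhoods force a directed triangle. A single
-- neighbourhood on one side spreads to every vertex by transitivity, which a
-- triangle on the other side contradicts. An automorphism carrying the
-- out-triangle onto the in-triangle moves v to a vertex all of whose
-- out-neighbours are in-neighbours of v, which is impossible. Finally, in a
-- single vertex or a triangle every vertex has at most one out- and one
-- in-neighbour, so an automorphism is determined by the image of one vertex;
-- this gives homogeneity.
module Submission where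

open import Defs
open import Data.Nat using (ℕ; zero; suc; _≥_)
open import Data.Product using (Σ; ∃; _×_; _,_; proj₁; proj₂)
open import Data.Sum using (_⊎_; inj₁; inj₂)
open import Data.Empty using (⊥; ⊥-elim)
open import Data.Bool using (true)
open import Data.Fin using (Fin; zero; suc; _≟_)
open import Data.Fin.Properties using (any?)
open import Data.Fin.Subset using (Subset; _∈_; _∉_; _⊆_; _⊂_; _∪_; ⊤; ⁅_⁆)
open import Data.Fin.Subset.Properties
  using (∈⊤; x∈⁅x⁆; x∈⁅y⁆⇒x≡y; x∈p∪q⁺; x∈p∪q⁻; _∈?_)
open import Data.Fin.Subset.Induction using (Acc; acc; ⊂-wellFounded)
open import Data.Vec using (tabulate)
open import Data.Vec.Properties using (lookup∘tabulate; []=⇒lookup; lookup⇒[]=)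
open import Function using (id; _∘_)
open import Function.Bundles using (Inverse; mk↔ₛ′)
open import Function.Construct.Identity using (↔-id)
open import Relation.Nullary using (¬_; Dec; yes; no; does; ¬?)
open import Relation.Nullary.Decidable using (_×-dec_; dec-true)
open import Level using (0ℓ)
open import Relation.Unary using (Pred; Decidable)
open import Relation.Binary.PropositionalEquality
  using (_≡_; _≢_; refl; sym; trans; cong; subst; subst₂)

module _ {n : ℕ} where

  select : {P : Pred (Fin n) 0ℓ} → Decidable P → Subset n
  select P? = tabulate (does ∘ P?)

  ∈-select⁺ : {P : Pred (Fin n) 0ℓ} (P? : Decidable P) {x : Fin n} → P x → x ∈ select P?
  ∈-select⁺ P? {x} p = lookup⇒[]= x _ (trans (lookup∘tabulate _ x) (dec-true (P? x) p))

  ∈-select⁻ : {P : Pred (Fin n) 0ℓ} (P? : Decidable P) {x : Fin n} → x ∈ select P? → P x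
  ∈-select⁻ P? {x} x∈ = does-true (P? x) (trans (sym (lookup∘tabulate _ x)) ([]=⇒lookup x∈))
    where
    does-true : ∀ {A : Set} (a? : Dec A) → does a? ≡ true → A
    does-true (yes a) _ = a

  ∈-insert-self : ∀ {v : Fin n} {U} → v ∈ ⁅ v ⁆ ∪ U
  ∈-insert-self {v} = x∈p∪q⁺ (inj₁ (x∈⁅x⁆ v))

  ∈-insert-there : ∀ {v x : Fin n} {U} → x ∈ U → x ∈ ⁅ v ⁆ ∪ U
  ∈-insert-there x∈ = x∈p∪q⁺ (inj₂ x∈)

  ∈-insert⁻ : ∀ {v x : Fin n} {U} → x ∈ ⁅ v ⁆ ∪ U → x ≡ v ⊎ x ∈ U
  ∈-insert⁻ {v} {U = U} x∈ with x∈p∪q⁻ ⁅ v ⁆ U x∈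
  ... | inj₁ x∈⁅v⁆ = inj₁ (x∈⁅y⁆⇒x≡y v x∈⁅v⁆)
  ... | inj₂ x∈U   = inj₂ x∈U

  ∈-insert-≢ : ∀ {v x : Fin n} {U} → x ∈ ⁅ v ⁆ ∪ U → x ≢ v → x ∈ U
  ∈-insert-≢ x∈ x≢v with ∈-insert⁻ x∈
  ... | inj₁ x≡v = ⊥-elim (x≢v x≡v)
  ... | inj₂ x∈U = x∈U

  insert-⊆ : ∀ {v : Fin n} {U S} → v ∈ S → U ⊆ S → ⁅ v ⁆ ∪ U ⊆ S
  insert-⊆ v∈S U⊆S x∈ with ∈-insert⁻ x∈
  ... | inj₁ refl = v∈S
  ... | inj₂ x∈U  = U⊆S x∈U

  Subsingleton : Subset n → Set
  Subsingleton S = ∀ {x y} → x ∈ S → y ∈ S → x ≡ y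

  subsingleton-or-distinct : (S : Subset n) →
    Subsingleton S ⊎ ∃ λ v → ∃ λ w → v ∈ S × w ∈ S × v ≢ w
  subsingleton-or-distinct S
    with any? (λ v → v ∈? S ×-dec any? (λ w → w ∈? S ×-dec ¬? (v ≟ w)))
  ... | yes (v , v∈ , w , w∈ , v≢w) = inj₂ (v , w , v∈ , w∈ , v≢w)
  ... | no none = inj₁ subsingleton
    where
    subsingleton : Subsingleton S
    subsingleton {x} {y} x∈ y∈ with x ≟ y
    ... | yes x≡y = x≡y
    ... | no x≢y  = ⊥-elim (none (x , x∈ , y , y∈ , x≢y))

Subsingleton-⊤⇒≡1 : ∀ {n} → n ≥ 1 → Subsingleton (⊤ {n}) → n ≡ 1
Subsingleton-⊤⇒≡1 {suc zero}    _ _ = refl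
Subsingleton-⊤⇒≡1 {suc (suc _)} _ single with single {zero} {suc zero} ∈⊤ ∈⊤
... | ()

D3-out-unique : ∀ {i j k} → D3-arc i j → D3-arc i k → j ≡ k
D3-out-unique a01 a01 = refl
D3-out-unique a12 a12 = refl
D3-out-unique a20 a20 = refl

D3-in-unique : ∀ {i j k} → D3-arc j i → D3-arc k i → j ≡ k
D3-in-unique a01 a01 = refl
D3-in-unique a12 a12 = refl
D3-in-unique a20 a20 = refl

D3-successor : ∀ i → ∃ λ j → D3-arc i j
D3-successor zero             = suc zero , a01
D3-successor (suc zero)       = suc (suc zero) , a12
D3-successor (suc (suc zero)) = zero , a20

D3-predecessor : ∀ i → ∃ λ j → D3-arc j i
D3-predecessor zero             = suc (suc zero) , a20
D3-predecessor (suc zero)       = zero , a01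
D3-predecessor (suc (suc zero)) = suc zero , a12

data Direction : Set where
  outward inward : Direction

opposite : Direction → Direction
opposite outward = inward
opposite inward  = outward

module _ {N : ℕ} (T : Tournament N) where

  infix 4 _⟶_ _⟶[_]_

  _⟶_ : Fin N → Fin N → Set
  _⟶_ = _⇒_ T

  _⟶[_]_ : Fin N → Direction → Fin N → Set
  x ⟶[ outward ] y = x ⟶ y
  x ⟶[ inward ]  y = y ⟶ x

  private variable
    d : Direction
    x y z u v w : Fin N
    S U V : Subset N
    f : Fin N → Fin N

  ⟶[]-asym : ∀ d → x ⟶[ d ] y → ¬ y ⟶[ d ] x
  ⟶[]-asym outward p q = antisym T _ _ p q
  ⟶[]-asym inward  p q = antisym T _ _ q p

  ⟶[]-irrefl : ∀ d → ¬ x ⟶[ d ] x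
  ⟶[]-irrefl d p = ⟶[]-asym d p p

  ⟶[]⇒≢ : ∀ d → x ⟶[ d ] y → x ≢ y
  ⟶[]⇒≢ d p refl = ⟶[]-irrefl d p

  ⟶[opposite] : ∀ d → x ⟶[ opposite d ] y → y ⟶[ d ] x
  ⟶[opposite] outward p = p
  ⟶[opposite] inward  p = p

  trichotomy : ∀ d x y → x ≡ y ⊎ x ⟶[ d ] y ⊎ y ⟶[ d ] x
  trichotomy d x y with x ≟ y
  ... | yes x≡y = inj₁ x≡y
  ... | no x≢y with d | total T x y x≢y
  ... | outward | inj₁ p = inj₂ (inj₁ p)
  ... | outward | inj₂ p = inj₂ (inj₂ p)
  ... | inward  | inj₁ p = inj₂ (inj₂ p)
  ... | inward  | inj₂ p = inj₂ (inj₁ p)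

  _⟶[_]?_ : ∀ x d y → Dec (x ⟶[ d ] y)
  x ⟶[ d ]? y with trichotomy d x y
  ... | inj₁ refl     = no (⟶[]-irrefl d)
  ... | inj₂ (inj₁ p) = yes p
  ... | inj₂ (inj₂ p) = no (⟶[]-asym d p)

  same-side : ∀ d → v ⟶[ d ] x → v ⟶[ d ] y → (v ⟶ x ⇔ v ⟶ y) × (x ⟶ v ⇔ y ⟶ v)
  same-side outward p q = ((λ _ → q) , (λ _ → p)) ,
                          ((λ r → ⊥-elim (⟶[]-asym outward p r)) , (λ r → ⊥-elim (⟶[]-asym outward q r)))
  same-side inward  p q = ((λ r → ⊥-elim (⟶[]-asym inward p r)) , (λ r → ⊥-elim (⟶[]-asym inward q r))) ,
                          ((λ _ → q) , (λ _ → p))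

  PartialIso-⟶[] : PartialIso T U V f → ∀ d → x ∈ U → y ∈ U → x ⟶[ d ] y → f x ⟶[ d ] f y
  PartialIso-⟶[] iso outward x∈ y∈ = proj₁ (PartialIso.arcs iso _ _ x∈ y∈)
  PartialIso-⟶[] iso inward  x∈ y∈ = proj₁ (PartialIso.arcs iso _ _ y∈ x∈)

  aut⁻¹ : Automorphism T → Fin N → Fin N
  aut⁻¹ g = Inverse.from (perm g)

  aut-aut⁻¹ : ∀ (g : Automorphism T) x → aut g (aut⁻¹ g x) ≡ x
  aut-aut⁻¹ g = Inverse.strictlyInverseˡ (perm g)

  aut-⟶[] : ∀ (g : Automorphism T) d → x ⟶[ d ] y ⇔ aut g x ⟶[ d ] aut g y
  aut-⟶[] g outward = arcs g _ _
  aut-⟶[] g inward  = arcs g _ _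

  aut⁻¹-injective : ∀ (g : Automorphism T) → aut⁻¹ g x ≡ aut⁻¹ g y → x ≡ y
  aut⁻¹-injective {x} {y} g e = trans (sym (aut-aut⁻¹ g x)) (trans (cong (aut g) e) (aut-aut⁻¹ g y))

  identity : Automorphism T
  identity = record { perm = ↔-id (Fin N) ; arcs = λ _ _ → id , id }

  opaque
    Nbhd : Direction → Subset N → Fin N → Subset N
    Nbhd d S v = select (λ x → x ∈? S ×-dec v ⟶[ d ]? x)

    ∈-Nbhd⁺ : x ∈ S → v ⟶[ d ] x → x ∈ Nbhd d S v
    ∈-Nbhd⁺ {S = S} {v = v} {d = d} x∈ p = ∈-select⁺ (λ x → x ∈? S ×-dec v ⟶[ d ]? x) (x∈ , p)

    ∈-Nbhd⁻ : x ∈ Nbhd d S v → x ∈ S × v ⟶[ d ] x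
    ∈-Nbhd⁻ {d = d} {S = S} {v = v} = ∈-select⁻ (λ x → x ∈? S ×-dec v ⟶[ d ]? x)

  Nbhd-⊆ : Nbhd d S v ⊆ S
  Nbhd-⊆ = proj₁ ∘ ∈-Nbhd⁻

  ∈-Nbhd⇒≢ : x ∈ Nbhd d S v → x ≢ v
  ∈-Nbhd⇒≢ {d = d} x∈ x≡v = ⟶[]⇒≢ d (proj₂ (∈-Nbhd⁻ x∈)) (sym x≡v)

  Nbhd-⊂ : v ∈ S → Nbhd d S v ⊂ S
  Nbhd-⊂ {v = v} v∈ = Nbhd-⊆ , v , v∈ , λ v∈N → ∈-Nbhd⇒≢ v∈N refl

  Stabilises : Automorphism T → Subset N → Set
  Stabilises g S = ∀ x → x ∈ S ⇔ aut g x ∈ S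

  record Carries (S U V : Subset N) : Set where
    field
      automorphism : Automorphism T
      stabilises   : Stabilises automorphism S
      maps-onto    : ∀ x → x ∈ S → x ∈ U ⇔ aut automorphism x ∈ V

  SetHomogeneousOn : Subset N → Set
  SetHomogeneousOn S = ∀ U V → U ⊆ S → V ⊆ S → U ≅[ T ] V → Carries S U V

  IsSetHomogeneous⇒On-⊤ : IsSetHomogeneous T → SetHomogeneousOn ⊤
  IsSetHomogeneous⇒On-⊤ sh U V _ _ U≅V with sh U V U≅V
  ... | g , onto = record { automorphism = g ; stabilises = λ _ → (λ _ → ∈⊤) , (λ _ → ∈⊤)
                          ; maps-onto = λ x _ → onto x }

  ⁅⁆-≅ : ∀ v w → ⁅ v ⁆ ≅[ T ] ⁅ w ⁆
  ⁅⁆-≅ v w = (λ _ → w) , record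
    { maps-into = λ _ _ → x∈⁅x⁆ w
    ; inj-on    = λ _ _ x∈ y∈ _ → trans (x∈⁅y⁆⇒x≡y v x∈) (sym (x∈⁅y⁆⇒x≡y v y∈))
    ; onto      = λ y y∈ → v , x∈⁅x⁆ v , sym (x∈⁅y⁆⇒x≡y w y∈)
    ; arcs      = λ x y x∈ y∈ → irreflexive (trans (x∈⁅y⁆⇒x≡y v x∈) (sym (x∈⁅y⁆⇒x≡y v y∈))) ,
                                 irreflexive refl
    }
    where
    irreflexive : ∀ {A : Set} {a b} → a ≡ b → a ⟶ b → A
    irreflexive refl p = ⊥-elim (⟶[]-irrefl outward p)

  vertex-transitive : SetHomogeneousOn S → v ∈ S → w ∈ S →
    Σ (Automorphism T) λ g → Stabilises g S × aut g v ≡ w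
  vertex-transitive {S} {v} {w} sh v∈ w∈ =
    automorphism , stabilises , x∈⁅y⁆⇒x≡y w (proj₁ (maps-onto v v∈) (x∈⁅x⁆ v))
    where
    singleton-⊆ : ∀ {x} → x ∈ S → ⁅ x ⁆ ⊆ S
    singleton-⊆ {x} x∈ y∈ = subst (_∈ S) (sym (x∈⁅y⁆⇒x≡y x y∈)) x∈
    open Carries (sh ⁅ v ⁆ ⁅ w ⁆ (singleton-⊆ v∈) (singleton-⊆ w∈) (⁅⁆-≅ v w))

  pull-back : ∀ d (g : Automorphism T) → Stabilises g S → aut g u ≡ w → x ∈ S → w ⟶[ d ] x →
    aut⁻¹ g x ∈ S × u ⟶[ d ] aut⁻¹ g x
  pull-back {S = S} {x = x} d g stab refl x∈ p =
    proj₂ (stab _) (subst (_∈ S) (sym (aut-aut⁻¹ g x)) x∈) ,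
    proj₂ (aut-⟶[] g d) (subst (_ ⟶[ d ]_) (sym (aut-aut⁻¹ g x)) p)

  -- If u had no d-neighbour in S then neither would its image w, yet w ⟶[ d ] u.
  neighbour-exists : ∀ d → SetHomogeneousOn S → u ∈ S → w ∈ S → u ≢ w →
    ∃ λ x → x ∈ S × u ⟶[ d ] x
  neighbour-exists {S} {u} {w} d sh u∈ w∈ u≢w with any? (λ x → x ∈? S ×-dec u ⟶[ d ]? x)
  ... | yes found = found
  ... | no none with trichotomy d u w
  ...   | inj₁ u≡w          = ⊥-elim (u≢w u≡w)
  ...   | inj₂ (inj₁ u⟶w)  = ⊥-elim (none (w , w∈ , u⟶w))
  ...   | inj₂ (inj₂ w⟶u) with vertex-transitive sh u∈ w∈
  ...     | g , stab , gu≡w = ⊥-elim (none (_ , pull-back d g stab gu≡w u∈ w⟶u))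

  Subsingleton-Nbhd-transfer : SetHomogeneousOn S → v ∈ S → u ∈ S →
    Subsingleton (Nbhd d S v) → Subsingleton (Nbhd d S u)
  Subsingleton-Nbhd-transfer {S = S} {v = v} {u = u} {d = d} sh v∈ u∈ single x∈ y∈
    with vertex-transitive sh v∈ u∈
  ... | g , stab , gv≡u = aut⁻¹-injective g (single (pulled x∈) (pulled y∈))
    where
    pulled : x ∈ Nbhd d S u → aut⁻¹ g x ∈ Nbhd d S v
    pulled x∈N with pull-back d g stab gv≡u (proj₁ (∈-Nbhd⁻ x∈N)) (proj₂ (∈-Nbhd⁻ x∈N))
    ... | y∈ , p = ∈-Nbhd⁺ y∈ p

  opaque
    fixing : Fin N → (Fin N → Fin N) → Fin N → Fin N
    fixing v f x with x ≟ v
    ... | yes _ = v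
    ... | no _  = f x

    fixing-self : fixing v f v ≡ v
    fixing-self {v} with v ≟ v
    ... | yes _   = refl
    ... | no v≢v = ⊥-elim (v≢v refl)

    fixing-other : x ≢ v → fixing v f x ≡ f x
    fixing-other {x} {v} x≢v with x ≟ v
    ... | yes x≡v = ⊥-elim (x≢v x≡v)
    ... | no _    = refl

  PartialIso-insert : PartialIso T U V f → v ∉ U → v ∉ V →
    (∀ {u} → u ∈ U → (v ⟶ u ⇔ v ⟶ f u) × (u ⟶ v ⇔ f u ⟶ v)) →
    PartialIso T (⁅ v ⁆ ∪ U) (⁅ v ⁆ ∪ V) (fixing v f)
  PartialIso-insert {U} {V} {f} {v} iso v∉U v∉V uniform = record
    { maps-into = maps-into ; inj-on = inj-on ; onto = onto ; arcs = arcs′ }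
    where
    module I = PartialIso iso
    fixing-U : ∀ {u} → u ∈ U → fixing v f u ≡ f u
    fixing-U u∈ = fixing-other λ { refl → v∉U u∈ }
    maps-into : ∀ x → x ∈ ⁅ v ⁆ ∪ U → fixing v f x ∈ ⁅ v ⁆ ∪ V
    maps-into x x∈ with ∈-insert⁻ x∈
    ... | inj₁ refl = subst (_∈ ⁅ v ⁆ ∪ V) (sym fixing-self) ∈-insert-self
    ... | inj₂ x∈U  = subst (_∈ ⁅ v ⁆ ∪ V) (sym (fixing-U x∈U)) (∈-insert-there (I.maps-into x x∈U))
    v≢image : ∀ {u} → u ∈ U → v ≢ fixing v f u
    v≢image {u} u∈ v≡ = v∉V (subst (_∈ V) (trans (sym (fixing-U u∈)) (sym v≡)) (I.maps-into u u∈))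
    inj-on : ∀ x y → x ∈ ⁅ v ⁆ ∪ U → y ∈ ⁅ v ⁆ ∪ U → fixing v f x ≡ fixing v f y → x ≡ y
    inj-on x y x∈ y∈ e with ∈-insert⁻ x∈ | ∈-insert⁻ y∈
    ... | inj₁ refl | inj₁ refl = refl
    ... | inj₁ refl | inj₂ y∈U  = ⊥-elim (v≢image y∈U (trans (sym fixing-self) e))
    ... | inj₂ x∈U  | inj₁ refl = ⊥-elim (v≢image x∈U (trans (sym fixing-self) (sym e)))
    ... | inj₂ x∈U  | inj₂ y∈U  =
      I.inj-on x y x∈U y∈U (trans (sym (fixing-U x∈U)) (trans e (fixing-U y∈U)))
    onto : ∀ y → y ∈ ⁅ v ⁆ ∪ V → ∃ λ x → x ∈ ⁅ v ⁆ ∪ U × fixing v f x ≡ y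
    onto y y∈ with ∈-insert⁻ y∈
    ... | inj₁ refl = v , ∈-insert-self , fixing-self
    ... | inj₂ y∈V with I.onto y y∈V
    ...   | x , x∈U , fx≡y = x , ∈-insert-there x∈U , trans (fixing-U x∈U) fx≡y
    arcs′ : ∀ x y → x ∈ ⁅ v ⁆ ∪ U → y ∈ ⁅ v ⁆ ∪ U → x ⟶ y ⇔ fixing v f x ⟶ fixing v f y
    arcs′ x y x∈ y∈ with ∈-insert⁻ x∈ | ∈-insert⁻ y∈
    ... | inj₁ refl | inj₁ refl = subst₂ (λ a b → v ⟶ v ⇔ a ⟶ b) (sym fixing-self) (sym fixing-self) (id , id)
    ... | inj₁ refl | inj₂ y∈U  = subst₂ (λ a b → v ⟶ y ⇔ a ⟶ b) (sym fixing-self) (sym (fixing-U y∈U))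
                                    (proj₁ (uniform y∈U))
    ... | inj₂ x∈U  | inj₁ refl = subst₂ (λ a b → x ⟶ v ⇔ a ⟶ b) (sym (fixing-U x∈U)) (sym fixing-self)
                                    (proj₂ (uniform x∈U))
    ... | inj₂ x∈U  | inj₂ y∈U  = subst₂ (λ a b → x ⟶ y ⇔ a ⟶ b) (sym (fixing-U x∈U)) (sym (fixing-U y∈U))
                                    (I.arcs x y x∈U y∈U)

  -- The preimage of v lies in ⁅ v ⁆ ∪ U; if it is not v, it is a d-neighbour
  -- of v, so g v ⟶[ d ] v, which contradicts g v being in V.
  Carries-insert-fixes : v ∈ S → U ⊆ Nbhd d S v → V ⊆ Nbhd d S v →
    (c : Carries S (⁅ v ⁆ ∪ U) (⁅ v ⁆ ∪ V)) → aut (Carries.automorphism c) v ≡ v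
  Carries-insert-fixes {v} {S} {U} {d} {V} v∈ U⊆ V⊆ c =
    fixed (∈-insert⁻ (proj₁ (maps-onto v v∈) ∈-insert-self))
    where
    open Carries c renaming (automorphism to g)
    preimage : Fin N
    preimage = aut⁻¹ g v
    preimage∈ : preimage ∈ ⁅ v ⁆ ∪ U
    preimage∈ = proj₂ (maps-onto preimage (proj₂ (stabilises preimage) (subst (_∈ S) (sym (aut-aut⁻¹ g v)) v∈)))
                      (subst (_∈ ⁅ v ⁆ ∪ V) (sym (aut-aut⁻¹ g v)) ∈-insert-self)
    gv⟶v : aut g v ∈ V → aut g v ⟶[ d ] v
    gv⟶v gv∈V with ∈-insert⁻ preimage∈
    ... | inj₁ preimage≡v = ⊥-elim (∈-Nbhd⇒≢ (V⊆ gv∈V)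
                              (trans (cong (aut g) (sym preimage≡v)) (aut-aut⁻¹ g v)))
    ... | inj₂ preimage∈U = subst (aut g v ⟶[ d ]_) (aut-aut⁻¹ g v)
                              (proj₁ (aut-⟶[] g d) (proj₂ (∈-Nbhd⁻ (U⊆ preimage∈U))))
    fixed : aut g v ≡ v ⊎ aut g v ∈ V → aut g v ≡ v
    fixed (inj₁ gv≡v) = gv≡v
    fixed (inj₂ gv∈V) = ⊥-elim (⟶[]-asym d (proj₂ (∈-Nbhd⁻ (V⊆ gv∈V))) (gv⟶v gv∈V))

  Nbhd-SetHomogeneous : SetHomogeneousOn S → v ∈ S → SetHomogeneousOn (Nbhd d S v)
  Nbhd-SetHomogeneous {S} {v} {d} sh v∈ U V U⊆ V⊆ (f , iso) = record
    { automorphism = g ; stabilises = stabilises-Nbhd ; maps-onto = maps-onto-Nbhd }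
    where
    arc-to : ∀ {x} → x ∈ Nbhd d S v → v ⟶[ d ] x
    arc-to = proj₂ ∘ ∈-Nbhd⁻
    c : Carries S (⁅ v ⁆ ∪ U) (⁅ v ⁆ ∪ V)
    c = sh _ _ (insert-⊆ v∈ (Nbhd-⊆ ∘ U⊆)) (insert-⊆ v∈ (Nbhd-⊆ ∘ V⊆))
           (fixing v f , PartialIso-insert iso (λ v∈U → ∈-Nbhd⇒≢ (U⊆ v∈U) refl)
                                               (λ v∈V → ∈-Nbhd⇒≢ (V⊆ v∈V) refl)
                                               (λ {u} u∈ → same-side d (arc-to (U⊆ u∈))
                                                              (arc-to (V⊆ (PartialIso.maps-into iso u u∈)))))
    open Carries c renaming (automorphism to g)
    gv≡v : aut g v ≡ v
    gv≡v = Carries-insert-fixes v∈ U⊆ V⊆ c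
    stabilises-Nbhd : Stabilises g (Nbhd d S v)
    stabilises-Nbhd x =
      (λ x∈ → ∈-Nbhd⁺ (proj₁ (stabilises x) (Nbhd-⊆ x∈))
                      (subst (_⟶[ d ] aut g x) gv≡v (proj₁ (aut-⟶[] g d) (arc-to x∈)))) ,
      (λ gx∈ → ∈-Nbhd⁺ (proj₂ (stabilises x) (Nbhd-⊆ gx∈))
                       (proj₂ (aut-⟶[] g d) (subst (_⟶[ d ] aut g x) (sym gv≡v) (arc-to gx∈))))
    maps-onto-Nbhd : ∀ x → x ∈ Nbhd d S v → x ∈ U ⇔ aut g x ∈ V
    maps-onto-Nbhd x x∈ =
      (λ x∈U → ∈-insert-≢ (proj₁ (maps-onto x (Nbhd-⊆ x∈)) (∈-insert-there x∈U))
                          (∈-Nbhd⇒≢ (proj₁ (stabilises-Nbhd x) x∈))) ,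
      (λ gx∈V → ∈-insert-≢ (proj₂ (maps-onto x (Nbhd-⊆ x∈)) (∈-insert-there gx∈V)) (∈-Nbhd⇒≢ x∈))

  record Triangle (S : Subset N) : Set where
    field
      corner   : Fin 3 → Fin N
      corner∈  : ∀ i → corner i ∈ S
      corner-⟶ : ∀ i j → corner i ⟶ corner j ⇔ D3-arc i j
      covers   : ∀ x → x ∈ S → ∃ λ i → corner i ≡ x

    corner-injective : ∀ i j → corner i ≡ corner j → i ≡ j
    corner-injective i j e with i ≟ j
    ... | yes i≡j = i≡j
    ... | no i≢j with total D3 i j i≢j
    ...   | inj₁ i⟶j = ⊥-elim (⟶[]⇒≢ outward (proj₂ (corner-⟶ i j) i⟶j) e)
    ...   | inj₂ j⟶i = ⊥-elim (⟶[]⇒≢ outward (proj₂ (corner-⟶ j i) j⟶i) (sym e))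

    index : Fin N → Fin 3
    index x with any? (λ i → corner i ≟ x)
    ... | yes (i , _) = i
    ... | no _        = zero

    index-corner : ∀ i → index (corner i) ≡ i
    index-corner i with any? (λ j → corner j ≟ corner i)
    ... | yes (j , e) = corner-injective j i e
    ... | no none     = ⊥-elim (none (i , refl))

    corner-index : x ∈ S → corner (index x) ≡ x
    corner-index {x} x∈ with covers x x∈
    ... | i , refl = cong corner (index-corner i)

    ⟶⇔D3-arc : x ∈ S → y ∈ S → x ⟶ y ⇔ D3-arc (index x) (index y)
    ⟶⇔D3-arc x∈ y∈ =
      subst₂ (λ a b → a ⟶ b ⇔ D3-arc (index _) (index _)) (corner-index x∈) (corner-index y∈)
             (corner-⟶ _ _)

    has-neighbour : ∀ d → x ∈ S → ∃ λ y → y ∈ S × x ⟶[ d ] y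
    has-neighbour {x} outward x∈ with D3-successor (index x)
    ... | j , arc = corner j , corner∈ j ,
                    subst (_⟶ corner j) (corner-index x∈) (proj₂ (corner-⟶ _ j) arc)
    has-neighbour {x} inward x∈ with D3-predecessor (index x)
    ... | j , arc = corner j , corner∈ j ,
                    subst (corner j ⟶_) (corner-index x∈) (proj₂ (corner-⟶ j _) arc)

    unique-neighbour : ∀ d → x ∈ S → y ∈ S → z ∈ S → x ⟶[ d ] y → x ⟶[ d ] z → y ≡ z
    unique-neighbour {y = y} {z = z} outward x∈ y∈ z∈ p q =
      trans (sym (corner-index y∈))
        (trans (cong corner (D3-out-unique (proj₁ (⟶⇔D3-arc x∈ y∈) p) (proj₁ (⟶⇔D3-arc x∈ z∈) q)))
               (corner-index z∈))
    unique-neighbour {y = y} {z = z} inward x∈ y∈ z∈ p q =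
      trans (sym (corner-index y∈))
        (trans (cong corner (D3-in-unique (proj₁ (⟶⇔D3-arc y∈ x∈) p) (proj₁ (⟶⇔D3-arc z∈ x∈) q)))
               (corner-index z∈))

  open Triangle

  triangle : x ∈ S → y ∈ S → z ∈ S → x ⟶ y → y ⟶ z → z ⟶ x →
    (∀ w → w ∈ S → w ≡ x ⊎ w ≡ y ⊎ w ≡ z) → Triangle S
  triangle {x} {S} {y} {z} x∈ y∈ z∈ x⟶y y⟶z z⟶x cover = record
    { corner = corner′ ; corner∈ = corner∈′ ; corner-⟶ = corner-⟶′ ; covers = covers′ }
    where
    corner′ : Fin 3 → Fin N
    corner′ zero             = x
    corner′ (suc zero)       = y
    corner′ (suc (suc zero)) = z
    corner∈′ : ∀ i → corner′ i ∈ S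
    corner∈′ zero             = x∈
    corner∈′ (suc zero)       = y∈
    corner∈′ (suc (suc zero)) = z∈
    no-arc : ∀ {a b i j} → b ⟶ a → ¬ D3-arc i j → a ⟶ b ⇔ D3-arc i j
    no-arc p ¬arc = (λ q → ⊥-elim (⟶[]-asym outward p q)) , λ arc → ⊥-elim (¬arc arc)
    loop : ∀ {a i j} → ¬ D3-arc i j → a ⟶ a ⇔ D3-arc i j
    loop ¬arc = (λ p → ⊥-elim (⟶[]-irrefl outward p)) , λ arc → ⊥-elim (¬arc arc)
    corner-⟶′ : ∀ i j → corner′ i ⟶ corner′ j ⇔ D3-arc i j
    corner-⟶′ zero             zero             = loop λ ()
    corner-⟶′ zero             (suc zero)       = (λ _ → a01) , (λ _ → x⟶y)
    corner-⟶′ zero             (suc (suc zero)) = no-arc z⟶x λ ()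
    corner-⟶′ (suc zero)       zero             = no-arc x⟶y λ ()
    corner-⟶′ (suc zero)       (suc zero)       = loop λ ()
    corner-⟶′ (suc zero)       (suc (suc zero)) = (λ _ → a12) , (λ _ → y⟶z)
    corner-⟶′ (suc (suc zero)) zero             = (λ _ → a20) , (λ _ → z⟶x)
    corner-⟶′ (suc (suc zero)) (suc zero)       = no-arc y⟶z λ ()
    corner-⟶′ (suc (suc zero)) (suc (suc zero)) = loop λ ()
    covers′ : ∀ w → w ∈ S → ∃ λ i → corner′ i ≡ w
    covers′ w w∈ with cover w w∈
    ... | inj₁ refl        = zero , refl
    ... | inj₂ (inj₁ refl) = suc zero , refl
    ... | inj₂ (inj₂ refl) = suc (suc zero) , refl

  Triangle-≅ : Triangle U → Triangle V → U ≅[ T ] V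
  Triangle-≅ {U} {V} A B = corner B ∘ index A , record
    { maps-into = λ x _ → corner∈ B (index A x)
    ; inj-on    = λ x y x∈ y∈ e → trans (sym (corner-index A x∈))
                    (trans (cong (corner A) (corner-injective B _ _ e)) (corner-index A y∈))
    ; onto      = λ y y∈ → corner A (index B y) , corner∈ A _ ,
                    trans (cong (corner B) (index-corner A _)) (corner-index B y∈)
    ; arcs      = λ x y x∈ y∈ →
                    (λ p → proj₂ (corner-⟶ B _ _) (proj₁ (⟶⇔D3-arc A x∈ y∈) p)) ,
                    (λ q → proj₂ (⟶⇔D3-arc A x∈ y∈) (proj₁ (corner-⟶ B _ _) q))
    }

  Triangle-⊤⇒≅D3 : Triangle ⊤ → T ≅ᵀ D3
  Triangle-⊤⇒≅D3 C = record
    { bij  = mk↔ₛ′ (index C) (corner C) (index-corner C) (λ x → corner-index C ∈⊤)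
    ; arcs = λ x y → ⟶⇔D3-arc C ∈⊤ ∈⊤
    }

  Nbhds-subsingleton⇒Triangle : SetHomogeneousOn S → v ∈ S → w ∈ S → v ≢ w →
    Subsingleton (Nbhd outward S v) → Subsingleton (Nbhd inward S v) → Triangle S
  Nbhds-subsingleton⇒Triangle {S} {v} sh v∈ w∈ v≢w out-single in-single
    with neighbour-exists outward sh v∈ w∈ v≢w | neighbour-exists inward sh v∈ w∈ v≢w
  ... | b , b∈ , v⟶b | c , c∈ , c⟶v = triangle v∈ b∈ c∈ v⟶b b⟶c c⟶v cover
    where
    b∈O : b ∈ Nbhd outward S v
    b∈O = ∈-Nbhd⁺ b∈ v⟶b
    c∈I : c ∈ Nbhd inward S v
    c∈I = ∈-Nbhd⁺ c∈ c⟶v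
    b⟶c : b ⟶ c
    b⟶c with neighbour-exists outward sh b∈ v∈ (⟶[]⇒≢ outward v⟶b ∘ sym)
    ... | e , e∈ , b⟶e with trichotomy outward e v
    ...   | inj₁ refl        = ⊥-elim (⟶[]-asym outward v⟶b b⟶e)
    ...   | inj₂ (inj₁ e⟶v) = subst (b ⟶_) (in-single (∈-Nbhd⁺ e∈ e⟶v) c∈I) b⟶e
    ...   | inj₂ (inj₂ v⟶e) =
      ⊥-elim (⟶[]⇒≢ outward b⟶e (out-single b∈O (∈-Nbhd⁺ e∈ v⟶e)))
    cover : ∀ x → x ∈ S → x ≡ v ⊎ x ≡ b ⊎ x ≡ c
    cover x x∈ with trichotomy outward x v
    ... | inj₁ x≡v        = inj₁ x≡v
    ... | inj₂ (inj₁ x⟶v) = inj₂ (inj₂ (in-single (∈-Nbhd⁺ x∈ x⟶v) c∈I))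
    ... | inj₂ (inj₂ v⟶x) = inj₂ (inj₁ (out-single (∈-Nbhd⁺ x∈ v⟶x) b∈O))

  -- A corner c of the triangle has two d-neighbours in S: v, and the next
  -- corner along direction d.
  ¬Subsingleton-Triangle-Nbhds : ∀ d → SetHomogeneousOn S → v ∈ S →
    Subsingleton (Nbhd d S v) → ¬ Triangle (Nbhd (opposite d) S v)
  ¬Subsingleton-Triangle-Nbhds {S} {v} d sh v∈ single C
    with ∈-Nbhd⁻ (corner∈ C zero)
  ... | c∈ , v⟶c with has-neighbour C d (corner∈ C zero)
  ...   | c′ , c′∈ , c⟶c′ with ∈-Nbhd⁻ c′∈
  ...     | c′∈S , v⟶c′ =
    ⟶[]-irrefl (opposite d) (subst (v ⟶[ opposite d ]_) (sym v≡c′) v⟶c′)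
    where
    v≡c′ : v ≡ c′
    v≡c′ = Subsingleton-Nbhd-transfer sh v∈ c∈ single
             (∈-Nbhd⁺ v∈ (⟶[opposite] d v⟶c)) (∈-Nbhd⁺ c′∈S c⟶c′)

  Carries-Nbhds⇒⟶ : (c : Carries S (Nbhd outward S v) (Nbhd inward S v)) →
    x ∈ S → aut (Carries.automorphism c) v ⟶ x → x ⟶ v
  Carries-Nbhds⇒⟶ {S} {v} {x} c x∈ gv⟶x =
    proj₂ (∈-Nbhd⁻ (subst (_∈ Nbhd inward S v) (aut-aut⁻¹ g x)
                          (proj₁ (maps-onto _ (proj₁ pulled)) (∈-Nbhd⁺ (proj₁ pulled) (proj₂ pulled)))))
    where
    open Carries c renaming (automorphism to g)
    pulled : aut⁻¹ g x ∈ S × v ⟶ aut⁻¹ g x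
    pulled = pull-back outward g stabilises refl x∈ gv⟶x

  -- Every out-neighbour of g v is an in-neighbour of v; no position of g v
  -- relative to v allows this.
  ¬Triangle-Triangle-Nbhds : SetHomogeneousOn S → v ∈ S →
    Triangle (Nbhd outward S v) → ¬ Triangle (Nbhd inward S v)
  ¬Triangle-Triangle-Nbhds {S} {v} sh v∈ O I = impossible (sh _ _ Nbhd-⊆ Nbhd-⊆ (Triangle-≅ O I))
    where
    impossible : Carries S (Nbhd outward S v) (Nbhd inward S v) → ⊥
    impossible c = position (trichotomy outward (aut g v) v)
      where
      open Carries c renaming (automorphism to g)
      into-v : x ∈ S → aut g v ⟶ x → x ⟶ v
      into-v = Carries-Nbhds⇒⟶ c
      b∈ : corner O zero ∈ Nbhd outward S v
      b∈ = corner∈ O zero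
      gv⟶gb : aut g v ⟶ aut g (corner O zero)
      gv⟶gb = proj₁ (aut-⟶[] g outward) (proj₂ (∈-Nbhd⁻ b∈))
      position : aut g v ≡ v ⊎ aut g v ⟶ v ⊎ v ⟶ aut g v → ⊥
      position (inj₁ gv≡v) =
        ⟶[]-asym outward (subst (_⟶ _) gv≡v gv⟶gb) (into-v (proj₁ (stabilises _) (Nbhd-⊆ b∈)) gv⟶gb)
      position (inj₂ (inj₁ gv⟶v)) = ⟶[]-irrefl outward (into-v v∈ gv⟶v)
      position (inj₂ (inj₂ v⟶gv)) with has-neighbour O outward (∈-Nbhd⁺ (proj₁ (stabilises v) v∈) v⟶gv)
      ... | b′ , b′∈ , gv⟶b′ = ⟶[]-asym outward (proj₂ (∈-Nbhd⁻ b′∈)) (into-v (Nbhd-⊆ b′∈) gv⟶b′)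

  classify : SetHomogeneousOn S → Acc _⊂_ S → Subsingleton S ⊎ Triangle S
  classify {S} sh (acc smaller) with subsingleton-or-distinct S
  ... | inj₁ single = inj₁ single
  ... | inj₂ (v , w , v∈ , w∈ , v≢w) = combine (neighbourhood outward) (neighbourhood inward)
    where
    neighbourhood : ∀ d → Subsingleton (Nbhd d S v) ⊎ Triangle (Nbhd d S v)
    neighbourhood d = classify (Nbhd-SetHomogeneous sh v∈) (smaller (Nbhd-⊂ v∈))
    combine : Subsingleton (Nbhd outward S v) ⊎ Triangle (Nbhd outward S v) →
              Subsingleton (Nbhd inward S v) ⊎ Triangle (Nbhd inward S v) →
              Subsingleton S ⊎ Triangle S
    combine (inj₁ out-single) (inj₁ in-single) =
      inj₂ (Nbhds-subsingleton⇒Triangle sh v∈ w∈ v≢w out-single in-single)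
    combine (inj₁ out-single) (inj₂ I) = ⊥-elim (¬Subsingleton-Triangle-Nbhds outward sh v∈ out-single I)
    combine (inj₂ O) (inj₁ in-single)  = ⊥-elim (¬Subsingleton-Triangle-Nbhds inward sh v∈ in-single O)
    combine (inj₂ O) (inj₂ I)          = ⊥-elim (¬Triangle-Triangle-Nbhds sh v∈ O I)

  -- An automorphism agreeing with f at one point of U agrees with it on all
  -- of U, since each x ∈ U is the unique d-neighbour of its image in some
  -- direction d.
  homogeneous : SetHomogeneousOn ⊤ →
    (∀ d {x y z} → x ⟶[ d ] y → x ⟶[ d ] z → y ≡ z) → IsHomogeneous T
  homogeneous sh unique U V f iso with any? (_∈? U)
  ... | no empty = identity , λ x x∈ → ⊥-elim (empty (x , x∈))
  ... | yes (x₀ , x₀∈) with vertex-transitive sh (∈⊤ {x = x₀}) (∈⊤ {x = f x₀})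
  ...   | g , _ , gx₀≡fx₀ = g , agrees
    where
    along : ∀ d {x} → x ∈ U → x₀ ⟶[ d ] x → aut g x ≡ f x
    along d x∈ p = unique d (subst (_⟶[ d ] aut g _) gx₀≡fx₀ (proj₁ (aut-⟶[] g d) p))
                            (PartialIso-⟶[] iso d x₀∈ x∈ p)
    agrees : ∀ x → x ∈ U → aut g x ≡ f x
    agrees x x∈ with trichotomy outward x₀ x
    ... | inj₁ refl          = gx₀≡fx₀
    ... | inj₂ (inj₁ x₀⟶x) = along outward x∈ x₀⟶x
    ... | inj₂ (inj₂ x⟶x₀) = along inward x∈ x⟶x₀

lemma3p1 : (n : ℕ) → n ≥ 1 → (M : Tournament n) → IsSetHomogeneous M →
    IsHomogeneous M × (n ≡ 1 ⊎ M ≅ᵀ D3)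
lemma3p1 n n≥1 M set-homogeneous = conclude (classify M sh (⊂-wellFounded ⊤))
  where
  sh : SetHomogeneousOn M ⊤
  sh = IsSetHomogeneous⇒On-⊤ M set-homogeneous
  conclude : Subsingleton ⊤ ⊎ Triangle M ⊤ → IsHomogeneous M × (n ≡ 1 ⊎ M ≅ᵀ D3)
  conclude (inj₁ single) =
    homogeneous M sh (λ _ _ _ → single ∈⊤ ∈⊤) , inj₁ (Subsingleton-⊤⇒≡1 n≥1 single)
  conclude (inj₂ C) =
    homogeneous M sh (λ d → Triangle.unique-neighbour C d ∈⊤ ∈⊤ ∈⊤) , inj₂ (Triangle-⊤⇒≅D3 M C)
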